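{- There is an undirected unweighted graph $G$ on $n$ vertices such that $G-e$ has diameter $2$ or $3$ for every edge $e\in E(G)$. Any data structure that decides which one is the case (i.e., given $e$, reports whether $\mathrm{diam}(G-e)$ is $2$ or $3$) must take $\Omega(n^2)$ bits of space.
   Context: $G-e$ is $G$ with edge $e$ removed; $\mathrm{diam}$ is the maximum shortest-path distance over pairs of vertices. The space lower bound is in the information-theoretic sense over a family of such graphs on $n$ vertices: the data structure must be able to distinguish the graphs in the family. -}

module Defs where

open import Data.Nat using (ℕ; zero; suc)
open import Data.Fin using (Fin; _≟_)
open import Data.Bool using (Bool; true; false; _∧_; _∨_; not)
open import Data.Product using (Σ; _×_; ∃-syntax)
open import Relation.Nullary using (¬_)
open import Relation.Nullary.Decidable using (⌊_⌋)
open import Relation.Binary.PropositionalEquality using (_≡_)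

record Graph (n : ℕ) : Set where
  constructor graph
  field
    adj : Fin n → Fin n → Bool

open Graph public

record IsSimple {n : ℕ} (G : Graph n) : Set where
  field
    symm    : ∀ u v → adj G u v ≡ adj G v u
    irrefl  : ∀ u → adj G u u ≡ false

IsEdge : ∀ {n} → Graph n → Fin n → Fin n → Set
IsEdge G a b = adj G a b ≡ true

removeEdge : ∀ {n} → Graph n → Fin n → Fin n → Graph n
removeEdge G a b = graph λ x y →
  adj G x y ∧ not ((⌊ x ≟ a ⌋ ∧ ⌊ y ≟ b ⌋) ∨ (⌊ x ≟ b ⌋ ∧ ⌊ y ≟ a ⌋))

-- Reach G k u v : there is a walk from u to v of length at most k,
-- i.e. the shortest-path distance dist_G(u,v) ≤ k.
data Reach {n : ℕ} (G : Graph n) : ℕ → Fin n → Fin n → Set where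
  here : ∀ {k : ℕ} {u : Fin n} → Reach G k u u
  step : ∀ {k : ℕ} {u w v : Fin n} → adj G u w ≡ true → Reach G k w v → Reach G (suc k) u v

-- diam G ≡ suc d : every pair is at distance ≤ suc d and some pair is at
-- distance > d  (so G is connected and its diameter is exactly suc d).
HasDiam : ∀ {n : ℕ} → Graph n → ℕ → Set
HasDiam {n} G zero    = (u v : Fin n) → u ≡ v
HasDiam {n} G (suc d) = (∀ u v → Reach G (suc d) u v) × (∃[ u ] ∃[ v ] ¬ Reach G d u v)

{-# OPTIONS --safe #-}
-- Fix an m × m bit matrix. The graph has three "x-hubs" adjacent to everything except the
-- vertices Y_j, three "y-hubs" adjacent to everything except the vertices X_i, vertices
-- X_i, Y_j, Z_k (i, j, k < m) with X–Y complete bipartite, X_i ~ Z_i and Y_j ~ Z_k iff bit k j,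
-- and padding vertices adjacent only to the hubs. Whatever edge is deleted, some x-hub and
-- some y-hub survive untouched; they are adjacent and together dominate the graph, so the
-- diameter is 2 or 3. Deleting X_p Y_q leaves every other pair within distance 2 (through a
-- common hub or a surviving X–Y edge), while X_p and Y_q are at distance 2 exactly when
-- bit p q holds (the only possible midpoint is Z_p). Distinct matrices therefore disagree on
-- some query, and m = ⌊n/4⌋ gives 2^(m²) ≥ 2^(n²/25) graphs on n vertices.
module Submission where

open import Defs
open import Data.Bool using (Bool; true; false; not; _∧_; _∨_)
open import Data.Bool.Properties using (∧-comm; ∨-comm; ∧-zeroʳ; ∧-conicalˡ; ∧-conicalʳ)
open import Data.Empty using (⊥-elim)
open import Data.Fin using (Fin; toℕ; fromℕ<; combine; remQuot; finToFun; funToFin; _≟_)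
open import Data.Fin.Patterns using (0F; 1F; 2F)
open import Data.Fin.Properties
  using (toℕ<n; toℕ-fromℕ<; toℕ-injective; fromℕ<-injective; any?; ¬∀⟶∃¬; combine-remQuot; funToFin-finToFin; 2↔Bool)
import Data.Fin as Fin
open import Data.Nat using (ℕ; zero; suc; _+_; _*_; _^_; _/_; _%_; _≤_; _<_; s≤s⁻¹)
open import Data.Nat.Properties
  using (≤-trans; <-≤-trans; m≤m+n; +-monoˡ-≤; +-monoʳ-<; *-mono-≤; ^-monoʳ-≤; +-cancelˡ-≡; module ≤-Reasoning)
open import Data.Nat.DivMod using (m≡m%n+[m/n]*n; m%n<n; m/n*n≤m; /-monoˡ-≤; m*n/n≡m)
open import Data.Nat.Tactic.RingSolver using (solve-∀)
open import Data.Product using (Σ; _×_; ∃-syntax; _,_; proj₂; uncurry)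
open import Data.Sum using (_⊎_; inj₁; inj₂; [_,_]′)
open import Function using (_∘_; const)
open import Function.Bundles using (Inverse; Injection)
open import Function.Definitions using (Injective)
open import Function.Properties.Inverse using (↔⇒↣)
open import Relation.Binary.Definitions using (DecidableEquality)
open import Relation.Binary.PropositionalEquality
open import Relation.Nullary using (¬_; Dec; yes; no; ¬?; contradiction)
open import Relation.Nullary.Decidable using (⌊_⌋; isYes≗does; dec-true; dec-false)

⌊⌋-true : ∀ {A : Set} (a? : Dec A) → A → ⌊ a? ⌋ ≡ true
⌊⌋-true a? a = trans (isYes≗does a?) (dec-true a? a)

⌊⌋-false : ∀ {A : Set} (a? : Dec A) → ¬ A → ⌊ a? ⌋ ≡ false
⌊⌋-false a? ¬a = trans (isYes≗does a?) (dec-false a? ¬a)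

⌊⌋-sound : ∀ {A : Set} (a? : Dec A) → ⌊ a? ⌋ ≡ true → A
⌊⌋-sound (yes a) _ = a

⌊≟⌋-sym : ∀ {n} (u v : Fin n) → ⌊ u ≟ v ⌋ ≡ ⌊ v ≟ u ⌋
⌊≟⌋-sym u v with u ≟ v
... | yes u≡v = sym (⌊⌋-true (v ≟ u) (sym u≡v))
... | no u≢v = sym (⌊⌋-false (v ≟ u) (u≢v ∘ sym))

module _ {n : ℕ} {G : Graph n} where

  Reach-suc : ∀ {k u v} → Reach G k u v → Reach G (suc k) u v
  Reach-suc here = here
  Reach-suc (step e r) = step e (Reach-suc r)

  Reach-snoc : ∀ {k u w v} → Reach G k u w → IsEdge G w v → Reach G (suc k) u v
  Reach-snoc here e = step e here
  Reach-snoc (step e′ r) e = step e′ (Reach-snoc r e)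

  Reach-1-inv : ∀ {u v} → Reach G 1 u v → u ≡ v ⊎ IsEdge G u v
  Reach-1-inv here = inj₁ refl
  Reach-1-inv (step e here) = inj₂ e

  Reach-2-inv : ∀ {u v} → Reach G 2 u v →
                u ≡ v ⊎ IsEdge G u v ⊎ ∃[ w ] (IsEdge G u w × IsEdge G w v)
  Reach-2-inv here = inj₁ refl
  Reach-2-inv (step e here) = inj₂ (inj₁ e)
  Reach-2-inv (step e (step e′ here)) = inj₂ (inj₂ (_ , e , e′))

  reach? : ∀ k u v → Dec (Reach G k u v)
  reach? zero u v with u ≟ v
  ... | yes refl = yes here
  ... | no u≢v = no λ { here → u≢v refl }
  reach? (suc k) u v with u ≟ v
  ... | yes refl = yes here
  ... | no u≢v with any? (λ w → firstStep? w)
    where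
      firstStep? : ∀ w → Dec (IsEdge G u w × Reach G k w v)
      firstStep? w with adj G u w | reach? k w v
      ... | true  | yes r = yes (refl , r)
      ... | true  | no ¬r = no (¬r ∘ proj₂)
      ... | false | _     = no λ ()
  ... | yes (w , e , r) = yes (step e r)
  ... | no ¬step = no λ { here → u≢v refl ; (step e r) → ¬step (_ , e , r) }

  diam-2-or-3 : ∀ {a b} → ¬ Reach G 1 a b → (∀ u v → Reach G 3 u v) → HasDiam G 2 ⊎ HasDiam G 3
  diam-2-or-3 {a} {b} ¬ab all3 with any? (λ u → any? (λ v → ¬? (reach? 2 u v)))
  ... | yes (u , v , ¬uv) = inj₂ (all3 , u , v , ¬uv)
  ... | no ¬far = inj₁ (all2 , a , b , ¬ab)
    where
      all2 : ∀ u v → Reach G 2 u v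
      all2 u v with reach? 2 u v
      ... | yes r = r
      ... | no ¬r = ⊥-elim (¬far (u , v , ¬r))

ClosedNbr : ∀ {n} → Graph n → Fin n → Fin n → Set
ClosedNbr G p v = v ≡ p ⊎ IsEdge G p v

module _ {n : ℕ} {G : Graph n} (simple : IsSimple G) where

  edge-sym : ∀ {u v} → IsEdge G u v → IsEdge G v u
  edge-sym {u} {v} e = trans (IsSimple.symm simple v u) e

  Reach-sym : ∀ {k u v} → Reach G k u v → Reach G k v u
  Reach-sym here = here
  Reach-sym (step e r) = Reach-snoc (Reach-sym r) (edge-sym e)

  private
    throughCentre : ∀ {k p u v} → ClosedNbr G p u → Reach G k p v → Reach G (suc k) u v
    throughCentre (inj₁ refl) r = Reach-suc r
    throughCentre (inj₂ e) r = step (edge-sym e) r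

    fromCentre : ∀ {p v} → ClosedNbr G p v → Reach G 1 p v
    fromCentre (inj₁ refl) = here
    fromCentre (inj₂ e) = step e here

  dominatingEdge⇒Reach3 : ∀ {p q} → IsEdge G p q → (∀ v → ClosedNbr G p v ⊎ ClosedNbr G q v) →
                          ∀ u v → Reach G 3 u v
  dominatingEdge⇒Reach3 pq cover u v with cover u | cover v
  ... | inj₁ pu | inj₁ pv = throughCentre pu (Reach-suc (fromCentre pv))
  ... | inj₁ pu | inj₂ qv = throughCentre pu (step pq (fromCentre qv))
  ... | inj₂ qu | inj₁ pv = throughCentre qu (step (edge-sym pq) (fromCentre pv))
  ... | inj₂ qu | inj₂ qv = throughCentre qu (Reach-suc (fromCentre qv))

module _ {n : ℕ} (G : Graph n) (a b : Fin n) where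

  removeEdge-⊆ : ∀ {x y} → IsEdge (removeEdge G a b) x y → IsEdge G x y
  removeEdge-⊆ e = ∧-conicalˡ _ _ e

  removeEdge-keeps : ∀ {x y} → IsEdge G x y → x ≢ a → x ≢ b → IsEdge (removeEdge G a b) x y
  removeEdge-keeps {x} e x≢a x≢b rewrite e | ⌊⌋-false (x ≟ a) x≢a | ⌊⌋-false (x ≟ b) x≢b = refl

  removeEdge-¬Reach1 : a ≢ b → ¬ Reach (removeEdge G a b) 1 a b
  removeEdge-¬Reach1 a≢b r with Reach-1-inv r
  ... | inj₁ a≡b = a≢b a≡b
  ... | inj₂ e rewrite ⌊⌋-true (a ≟ a) refl | ⌊⌋-true (b ≟ b) refl =
    contradiction (trans (sym e) (∧-zeroʳ (adj G a b))) λ ()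

  removeEdge-simple : IsSimple G → IsSimple (removeEdge G a b)
  removeEdge-simple simple = record
    { symm = λ u v → cong₂ (λ s t → s ∧ not t) (IsSimple.symm simple u v)
        (trans (∨-comm (⌊ u ≟ a ⌋ ∧ ⌊ v ≟ b ⌋) _) (cong₂ _∨_ (∧-comm ⌊ u ≟ b ⌋ _) (∧-comm ⌊ u ≟ a ⌋ _)))
    ; irrefl = λ u → cong (_∧ _) (IsSimple.irrefl simple u)
    }

module _ {A : Set} (_≟ᴬ_ : DecidableEquality A) where

  one-of-two-avoids : ∀ {c c′} → c ≢ c′ → ∀ x → c ≢ x ⊎ c′ ≢ x
  one-of-two-avoids {c} c≢c′ x with c ≟ᴬ x
  ... | yes refl = inj₂ (c≢c′ ∘ sym)
  ... | no c≢x = inj₁ c≢x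

  three-avoid-two : (f : Fin 3 → A) → Injective _≡_ _≡_ f → ∀ x y → ∃[ c ] (f c ≢ x × f c ≢ y)
  three-avoid-two f inj x y with f 0F ≟ᴬ x | f 0F ≟ᴬ y
  ... | no f₀≢x | no f₀≢y = 0F , f₀≢x , f₀≢y
  ... | yes refl | _ = [ (λ f₁≢y → 1F , (λ ()) ∘ inj , f₁≢y) , (λ f₂≢y → 2F , (λ ()) ∘ inj , f₂≢y) ]′
                         (one-of-two-avoids ((λ ()) ∘ inj) y)
  ... | no _ | yes refl = [ (λ f₁≢x → 1F , f₁≢x , (λ ()) ∘ inj) , (λ f₂≢x → 2F , f₂≢x , (λ ()) ∘ inj) ]′
                            (one-of-two-avoids ((λ ()) ∘ inj) x)

module Labelled {n : ℕ} {L : Set} (label : Fin n → L) (_~_ : L → L → Bool) where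

  labelGraph : Graph n
  labelGraph = graph λ u v → not ⌊ u ≟ v ⌋ ∧ (label u ~ label v)

  labelGraph-simple : (∀ k l → k ~ l ≡ l ~ k) → IsSimple labelGraph
  labelGraph-simple ~-sym = record
    { symm = λ u v → cong₂ (λ s t → not s ∧ t) (⌊≟⌋-sym u v) (~-sym (label u) (label v))
    ; irrefl = λ u → cong (λ s → not s ∧ (label u ~ label u)) (⌊⌋-true (u ≟ u) refl)
    }

  labelGraph-edge : ∀ {u v} → u ≢ v → label u ~ label v ≡ true → IsEdge labelGraph u v
  labelGraph-edge {u} {v} u≢v uv rewrite ⌊⌋-false (u ≟ v) u≢v | uv = refl

  labelGraph-edge⁻ : ∀ {u v} → IsEdge labelGraph u v → label u ~ label v ≡ true
  labelGraph-edge⁻ {u} {v} e = ∧-conicalʳ (not ⌊ u ≟ v ⌋) _ e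

  label-≢ : ∀ {u v k l} → label u ≡ k → label v ≡ l → k ≢ l → u ≢ v
  label-≢ refl refl k≢l refl = k≢l refl

prepend : ∀ {A : Set} m → (Fin m → A) → (ℕ → A) → ℕ → A
prepend zero f g t = g t
prepend (suc m) f g zero = f 0F
prepend (suc m) f g (suc t) = prepend m (f ∘ Fin.suc) g t

prepend-toℕ : ∀ {A : Set} {m} (f : Fin m → A) g (i : Fin m) → prepend m f g (toℕ i) ≡ f i
prepend-toℕ f g 0F = refl
prepend-toℕ f g (Fin.suc i) = prepend-toℕ (f ∘ Fin.suc) g i

prepend-+ : ∀ {A : Set} m (f : Fin m → A) g t → prepend m f g (m + t) ≡ g t
prepend-+ zero f g t = refl
prepend-+ (suc m) f g t = prepend-+ m (f ∘ Fin.suc) g t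

data Hub : Set where
  xHub yHub : Hub

data Kind (m : ℕ) : Set where
  hub : Hub → Kind m
  pad : Kind m
  X Y Z : Fin m → Kind m

module Kinds {m : ℕ} (bit : Fin m → Fin m → Bool) where

  link : Kind m → Kind m → Bool
  link (hub xHub) (Y _) = false
  link (hub yHub) (X _) = false
  link (hub _) _ = true
  link (X _) (Y _) = true
  link (X i) (Z k) = ⌊ i ≟ k ⌋
  link (Y j) (Z k) = bit k j
  link _ _ = false

  _~_ : Kind m → Kind m → Bool
  k ~ l = link k l ∨ link l k

  ~-sym : ∀ k l → k ~ l ≡ l ~ k
  ~-sym k l = ∨-comm (link k l) (link l k)

  xHub-~ : ∀ k → hub xHub ~ k ≡ true ⊎ ∃[ j ] k ≡ Y j
  xHub-~ (hub _) = inj₁ refl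
  xHub-~ pad = inj₁ refl
  xHub-~ (X _) = inj₁ refl
  xHub-~ (Y j) = inj₂ (j , refl)
  xHub-~ (Z _) = inj₁ refl

  yHub-~ : ∀ k → hub yHub ~ k ≡ true ⊎ ∃[ i ] k ≡ X i
  yHub-~ (hub _) = inj₁ refl
  yHub-~ pad = inj₁ refl
  yHub-~ (X i) = inj₂ (i , refl)
  yHub-~ (Y _) = inj₁ refl
  yHub-~ (Z _) = inj₁ refl

  hub-cover : ∀ k → hub xHub ~ k ≡ true ⊎ hub yHub ~ k ≡ true
  hub-cover k with xHub-~ k
  ... | inj₁ xk = inj₁ xk
  ... | inj₂ (_ , refl) = inj₂ refl

  CommonHub : Kind m → Kind m → Set
  CommonHub k l = ∃[ h ] (k ~ hub h ≡ true × hub h ~ l ≡ true)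

  Cross : Kind m → Kind m → Set
  Cross k l = ∃[ i ] ∃[ j ] ((k ≡ X i × l ≡ Y j) ⊎ (k ≡ Y j × l ≡ X i))

  commonHub-or-cross : ∀ k l → CommonHub k l ⊎ Cross k l
  commonHub-or-cross k l with xHub-~ k | xHub-~ l
  ... | inj₁ xk | inj₁ xl = inj₁ (xHub , trans (~-sym k _) xk , xl)
  ... | inj₂ (j , refl) | _ with yHub-~ l
  ...   | inj₁ yl = inj₁ (yHub , refl , yl)
  ...   | inj₂ (i , refl) = inj₂ (i , j , inj₂ (refl , refl))
  commonHub-or-cross k l | inj₁ _ | inj₂ (j , refl) with yHub-~ k
  ...   | inj₁ yk = inj₁ (yHub , trans (~-sym k _) yk , refl)
  ...   | inj₂ (i , refl) = inj₂ (i , j , inj₁ (refl , refl))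

  X-Y-commonNbr : ∀ {p q} k → X p ~ k ≡ true → k ~ Y q ≡ true → bit p q ≡ true
  X-Y-commonNbr (hub xHub) _ ()
  X-Y-commonNbr (hub yHub) () _
  X-Y-commonNbr pad () _
  X-Y-commonNbr (X _) () _
  X-Y-commonNbr (Y _) _ ()
  X-Y-commonNbr {p} (Z k) pk kq with ⌊⌋-sound (p ≟ k) (trans (~-sym (Z k) (X p)) pk)
  ... | refl = kq

kindAt : ∀ {m} → ℕ → Kind m
kindAt {m} = prepend 3 (const (hub xHub)) (prepend 3 (const (hub yHub))
               (prepend m X (prepend m Y (prepend m Z (const pad)))))

hubPos : Hub → Fin 3 → ℕ
hubPos xHub c = toℕ c
hubPos yHub c = 3 + toℕ c

hubPos<6 : ∀ h c → hubPos h c < 6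
hubPos<6 xHub c = <-≤-trans (toℕ<n c) (m≤m+n 3 3)
hubPos<6 yHub c = +-monoʳ-< 3 (toℕ<n c)

hubPos-injective : ∀ h → Injective _≡_ _≡_ (hubPos h)
hubPos-injective xHub = toℕ-injective
hubPos-injective yHub = toℕ-injective ∘ +-cancelˡ-≡ 3 _ _

module Layout {n m : ℕ} (room : 6 + (m + (m + m)) ≤ n) where

  kind : Fin n → Kind m
  kind v = kindAt (toℕ v)

  vertexAt : ∀ {t} → t < 6 + (m + (m + m)) → Fin n
  vertexAt t<room = fromℕ< (<-≤-trans t<room room)

  kind-vertexAt : ∀ {t} (t<room : t < 6 + (m + (m + m))) → kind (vertexAt t<room) ≡ kindAt t
  kind-vertexAt t<room = cong kindAt (toℕ-fromℕ< (<-≤-trans t<room room))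

  hubPos<room : ∀ h c → hubPos h c < 6 + (m + (m + m))
  hubPos<room h c = <-≤-trans (hubPos<6 h c) (m≤m+n 6 _)

  xPos<room : ∀ (i : Fin m) → 6 + toℕ i < 6 + (m + (m + m))
  xPos<room i = +-monoʳ-< 6 (<-≤-trans (toℕ<n i) (m≤m+n m _))

  yPos<room : ∀ (j : Fin m) → 6 + (m + toℕ j) < 6 + (m + (m + m))
  yPos<room j = +-monoʳ-< 6 (+-monoʳ-< m (<-≤-trans (toℕ<n j) (m≤m+n m m)))

  zPos<room : ∀ (k : Fin m) → 6 + (m + (m + toℕ k)) < 6 + (m + (m + m))
  zPos<room k = +-monoʳ-< 6 (+-monoʳ-< m (+-monoʳ-< m (toℕ<n k)))

  hubVertex : Hub → Fin 3 → Fin n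
  hubVertex h c = vertexAt (hubPos<room h c)

  xv yv zv : Fin m → Fin n
  xv i = vertexAt (xPos<room i)
  yv j = vertexAt (yPos<room j)
  zv k = vertexAt (zPos<room k)

  kind-hubVertex : ∀ h c → kind (hubVertex h c) ≡ hub h
  kind-hubVertex xHub c = trans (kind-vertexAt (hubPos<room xHub c)) (prepend-toℕ _ _ c)
  kind-hubVertex yHub c = trans (kind-vertexAt (hubPos<room yHub c)) (prepend-toℕ _ _ c)

  kind-xv : ∀ i → kind (xv i) ≡ X i
  kind-xv i = trans (kind-vertexAt (xPos<room i)) (prepend-toℕ X _ i)

  kind-yv : ∀ j → kind (yv j) ≡ Y j
  kind-yv j = trans (kind-vertexAt (yPos<room j)) (trans (prepend-+ m X _ _) (prepend-toℕ Y _ j))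

  kind-zv : ∀ k → kind (zv k) ≡ Z k
  kind-zv k = trans (kind-vertexAt (zPos<room k))
    (trans (prepend-+ m X _ _) (trans (prepend-+ m Y _ _) (prepend-toℕ Z _ k)))

  hubVertex-injective : ∀ h → Injective _≡_ _≡_ (hubVertex h)
  hubVertex-injective h = hubPos-injective h ∘ fromℕ<-injective _ _ _ _

  hub-avoiding : ∀ h a b → ∃[ c ] (hubVertex h c ≢ a × hubVertex h c ≢ b)
  hub-avoiding h = three-avoid-two _≟_ (hubVertex h) (hubVertex-injective h)

module Construction {n m : ℕ} (room : 6 + (m + (m + m)) ≤ n) (bit : Fin m → Fin m → Bool) where

  open Layout {n} {m} room
  open Kinds bit
  open Labelled kind _~_

  -- Opaque so that IsEdge G u v does not unfold and u, v stay inferable from it.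
  opaque
    G : Graph n
    G = labelGraph

  opaque
    unfolding G

    G-simple : IsSimple G
    G-simple = labelGraph-simple ~-sym

    edge-of-kinds : ∀ {u v k l} → u ≢ v → kind u ≡ k → kind v ≡ l → k ~ l ≡ true → IsEdge G u v
    edge-of-kinds u≢v refl refl = labelGraph-edge u≢v

    kinds-of-edge : ∀ {u v} → IsEdge G u v → kind u ~ kind v ≡ true
    kinds-of-edge {u} {v} = labelGraph-edge⁻ {u} {v}

  module _ (a b : Fin n) where

    private
      H : Graph n
      H = removeEdge G a b

    closedNbr-of-avoiding : ∀ {p v} → p ≢ a → p ≢ b → kind p ~ kind v ≡ true → ClosedNbr H p v
    closedNbr-of-avoiding {p} {v} p≢a p≢b pv with v ≟ p
    ... | yes v≡p = inj₁ v≡p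
    ... | no v≢p = inj₂ (removeEdge-keeps G a b (edge-of-kinds (v≢p ∘ sym) refl refl pv) p≢a p≢b)

    removeEdge-Reach3 : ∀ u v → Reach H 3 u v
    removeEdge-Reach3 with hub-avoiding xHub a b | hub-avoiding yHub a b
    ... | c , p≢a , p≢b | c′ , q≢a , q≢b =
      dominatingEdge⇒Reach3 (removeEdge-simple G a b G-simple) pq cover
      where
        p q : Fin n
        p = hubVertex xHub c
        q = hubVertex yHub c′

        pq : IsEdge H p q
        pq = removeEdge-keeps G a b
               (edge-of-kinds (label-≢ (kind-hubVertex xHub c) (kind-hubVertex yHub c′) λ ())
                              (kind-hubVertex xHub c) (kind-hubVertex yHub c′) refl)
               p≢a p≢b

        cover : ∀ v → ClosedNbr H p v ⊎ ClosedNbr H q v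
        cover v with hub-cover (kind v)
        ... | inj₁ xv′ = inj₁ (closedNbr-of-avoiding p≢a p≢b
                                 (subst (λ k → k ~ kind v ≡ true) (sym (kind-hubVertex xHub c)) xv′))
        ... | inj₂ yv′ = inj₂ (closedNbr-of-avoiding q≢a q≢b
                                 (subst (λ k → k ~ kind v ≡ true) (sym (kind-hubVertex yHub c′)) yv′))

    removeEdge-diam-2-or-3 : IsEdge G a b → HasDiam H 2 ⊎ HasDiam H 3
    removeEdge-diam-2-or-3 ab = diam-2-or-3 (removeEdge-¬Reach1 G a b a≢b) removeEdge-Reach3
      where
        a≢b : a ≢ b
        a≢b refl = contradiction (trans (sym ab) (IsSimple.irrefl G-simple a)) λ ()

  module _ (p q : Fin m) where

    private
      H : Graph n
      H = removeEdge G (xv p) (yv q)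

      H-simple : IsSimple H
      H-simple = removeEdge-simple G (xv p) (yv q) G-simple

      keep : ∀ {u v} → IsEdge G u v → u ≢ xv p → u ≢ yv q → IsEdge H u v
      keep = removeEdge-keeps G (xv p) (yv q)

    xv≢yv : xv p ≢ yv q
    xv≢yv = label-≢ (kind-xv p) (kind-yv q) λ ()

    xv-yv-edge : IsEdge G (xv p) (yv q)
    xv-yv-edge = edge-of-kinds xv≢yv (kind-xv p) (kind-yv q) refl

    ¬Reach2-if-bit-false : bit p q ≡ false → ¬ Reach H 2 (xv p) (yv q)
    ¬Reach2-if-bit-false bit≡false r with Reach-2-inv r
    ... | inj₁ xv≡yv = xv≢yv xv≡yv
    ... | inj₂ (inj₁ e) = removeEdge-¬Reach1 G (xv p) (yv q) xv≢yv (step e here)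
    ... | inj₂ (inj₂ (w , e₁ , e₂)) = contradiction (trans (sym bit≡true) bit≡false) λ ()
      where
        bit≡true : bit p q ≡ true
        bit≡true = X-Y-commonNbr (kind w)
          (subst (λ k → k ~ kind w ≡ true) (kind-xv p) (kinds-of-edge (removeEdge-⊆ G (xv p) (yv q) e₁)))
          (subst (λ k → kind w ~ k ≡ true) (kind-yv q) (kinds-of-edge (removeEdge-⊆ G (xv p) (yv q) e₂)))

    Reach2-via-hub : ∀ {u v} h → kind u ~ hub h ≡ true → hub h ~ kind v ≡ true → Reach H 2 u v
    Reach2-via-hub {u} {v} h uh hv with hub-avoiding h u v
    ... | c , c≢u , c≢v =
      step (edge-sym H-simple (keep (edge-of-kinds c≢u (kind-hubVertex h c) refl (trans (~-sym _ (kind u)) uh))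
                                     c≢xv c≢yv))
           (step (keep (edge-of-kinds c≢v (kind-hubVertex h c) refl hv) c≢xv c≢yv) here)
      where
        c≢xv : hubVertex h c ≢ xv p
        c≢xv = label-≢ (kind-hubVertex h c) (kind-xv p) λ ()
        c≢yv : hubVertex h c ≢ yv q
        c≢yv = label-≢ (kind-hubVertex h c) (kind-yv q) λ ()

    module _ (bit≡true : bit p q ≡ true) where

      Reach2-X-Y : ∀ {u v i j} → kind u ≡ X i → kind v ≡ Y j → Reach H 2 u v
      Reach2-X-Y {u} {v} ku kv with u ≟ xv p | v ≟ yv q
      ... | yes refl | yes refl =
        step (edge-sym H-simple (keep (edge-of-kinds zv≢xv (kind-zv p) (kind-xv p) (⌊⌋-true (p ≟ p) refl))
                                      zv≢xv zv≢yv))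
             (step (keep (edge-of-kinds zv≢yv (kind-zv p) (kind-yv q) bit≡true) zv≢xv zv≢yv) here)
        where
          zv≢xv : zv p ≢ xv p
          zv≢xv = label-≢ (kind-zv p) (kind-xv p) λ ()
          zv≢yv : zv p ≢ yv q
          zv≢yv = label-≢ (kind-zv p) (kind-yv q) λ ()
      ... | no u≢xv | _ =
        Reach-suc (step (keep (edge-of-kinds (label-≢ ku kv λ ()) ku kv refl)
                              u≢xv (label-≢ ku (kind-yv q) λ ())) here)
      ... | yes refl | no v≢yv =
        Reach-suc (step (edge-sym H-simple (keep (edge-of-kinds (label-≢ kv ku λ ()) kv ku refl)
                                                 (label-≢ kv (kind-xv p) λ ()) v≢yv)) here)

      Reach2-if-bit-true : ∀ u v → Reach H 2 u v
      Reach2-if-bit-true u v with commonHub-or-cross (kind u) (kind v)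
      ... | inj₁ (h , uh , hv) = Reach2-via-hub h uh hv
      ... | inj₂ (_ , _ , inj₁ (ku , kv)) = Reach2-X-Y ku kv
      ... | inj₂ (_ , _ , inj₂ (ku , kv)) = Reach-sym H-simple (Reach2-X-Y kv ku)

    diam2-if-bit-true : bit p q ≡ true → HasDiam H 2
    diam2-if-bit-true bit≡true =
      Reach2-if-bit-true bit≡true , xv p , yv q , removeEdge-¬Reach1 G (xv p) (yv q) xv≢yv

    diam3-if-bit-false : bit p q ≡ false → HasDiam H 3
    diam3-if-bit-false bit≡false =
      removeEdge-Reach3 (xv p) (yv q) , xv p , yv q , ¬Reach2-if-bit-false bit≡false

Separates : ∀ {n} → Graph n → Graph n → Fin n → Fin n → Set
Separates G G′ a b = IsEdge G a b × IsEdge G′ a b ×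
  ((HasDiam (removeEdge G a b) 2 × HasDiam (removeEdge G′ a b) 3) ⊎
   (HasDiam (removeEdge G a b) 3 × HasDiam (removeEdge G′ a b) 2))

module _ {n m : ℕ} (room : 6 + (m + (m + m)) ≤ n) where

  open Layout {n} {m} room using (xv; yv)
  open Construction {n} {m} room

  bit-separates : ∀ bit bit′ p q → bit p q ≢ bit′ p q → Separates (G bit) (G bit′) (xv p) (yv q)
  bit-separates bit bit′ p q differ with bit p q in e | bit′ p q in e′
  ... | true  | true  = ⊥-elim (differ refl)
  ... | false | false = ⊥-elim (differ refl)
  ... | true  | false = xv-yv-edge bit p q , xv-yv-edge bit′ p q ,
                        inj₁ (diam2-if-bit-true bit p q e , diam3-if-bit-false bit′ p q e′)
  ... | false | true  = xv-yv-edge bit p q , xv-yv-edge bit′ p q ,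
                        inj₂ (diam3-if-bit-false bit p q e , diam2-if-bit-true bit′ p q e′)

funToFin-cong : ∀ {k N} {f g : Fin N → Fin k} → f ≗ g → funToFin f ≡ funToFin g
funToFin-cong {N = zero} f≗g = refl
funToFin-cong {N = suc N} f≗g = cong₂ combine (f≗g 0F) (funToFin-cong (f≗g ∘ Fin.suc))

finToFun-≢ : ∀ {k N} {i j : Fin (k ^ N)} → i ≢ j → ∃[ r ] finToFun i r ≢ finToFun j r
finToFun-≢ {k} {N} {i} {j} i≢j =
  ¬∀⟶∃¬ N (λ r → finToFun i r ≡ finToFun j r) (λ r → finToFun i r ≟ finToFun j r) λ i≗j →
    i≢j (trans (sym (funToFin-finToFin {N} {k} i))
               (trans (funToFin-cong i≗j) (funToFin-finToFin {N} {k} j)))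

bitPattern : ∀ {m} → Fin (2 ^ (m * m)) → Fin m → Fin m → Bool
bitPattern {m} i p q = Inverse.to 2↔Bool (finToFun {2} {m * m} i (combine p q))

bitPattern-≢ : ∀ {m} {i j : Fin (2 ^ (m * m))} → i ≢ j →
               ∃[ p ] ∃[ q ] bitPattern i p q ≢ bitPattern j p q
bitPattern-≢ {m} {i} {j} i≢j with finToFun-≢ {2} {m * m} i≢j
... | r , differ with remQuot {m} m r in pq≡
... | p , q = p , q ,
  differ ∘ subst (λ s → finToFun i s ≡ finToFun j s) combine≡r ∘ Injection.injective (↔⇒↣ 2↔Bool)
  where
    combine≡r : combine p q ≡ r
    combine≡r = trans (cong (uncurry combine) (sym pq≡)) (combine-remQuot {m} m r)

module _ (n : ℕ) where

  private
    m : ℕ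
    m = n / 4

  quarter-room : 24 ≤ n → 6 + (m + (m + m)) ≤ n
  quarter-room 24≤n = begin
    6 + (m + (m + m)) ≤⟨ +-monoˡ-≤ (m + (m + m)) (/-monoˡ-≤ 4 24≤n) ⟩
    m + (m + (m + m)) ≡⟨ times-four m ⟩
    m * 4             ≤⟨ m/n*n≤m n 4 ⟩
    n                 ∎
    where
      open ≤-Reasoning
      times-four : ∀ k → k + (k + (k + k)) ≡ k * 4
      times-four = solve-∀

  ≤-five-quarters : 12 ≤ n → n ≤ m * 5
  ≤-five-quarters 12≤n = begin
    n             ≡⟨ m≡m%n+[m/n]*n n 4 ⟩
    n % 4 + m * 4 ≤⟨ +-monoˡ-≤ (m * 4) (≤-trans (s≤s⁻¹ (m%n<n n 4)) (/-monoˡ-≤ 4 12≤n)) ⟩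
    m + m * 4     ≡⟨ times-five m ⟩
    m * 5         ∎
    where
      open ≤-Reasoning
      times-five : ∀ k → k + k * 4 ≡ k * 5
      times-five = solve-∀

  square/25≤quarter² : 12 ≤ n → n * n / 25 ≤ m * m
  square/25≤quarter² 12≤n = begin
    n * n / 25             ≤⟨ /-monoˡ-≤ 25 (*-mono-≤ (≤-five-quarters 12≤n) (≤-five-quarters 12≤n)) ⟩
    (m * 5) * (m * 5) / 25 ≡⟨ cong (_/ 25) (square-times-25 m) ⟩
    m * m * 25 / 25        ≡⟨ m*n/n≡m (m * m) 25 ⟩
    m * m                  ∎
    where
      open ≤-Reasoning
      square-times-25 : ∀ k → (k * 5) * (k * 5) ≡ k * k * 25
      square-times-25 = solve-∀

lemma11 : Σ ℕ λ c → Σ ℕ λ n₀ → ∀ n → n₀ ≤ n →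
          Σ ℕ λ k → (2 ^ (n * n / suc c) ≤ k) ×
          Σ (Fin k → Graph n) λ F →
            (∀ i → IsSimple (F i)) ×
            (∀ i a b → IsEdge (F i) a b →
               HasDiam (removeEdge (F i) a b) 2 ⊎ HasDiam (removeEdge (F i) a b) 3) ×
            (∀ i j → i ≢ j → ∃[ a ] ∃[ b ] (IsEdge (F i) a b × IsEdge (F j) a b ×
               ((HasDiam (removeEdge (F i) a b) 2 × HasDiam (removeEdge (F j) a b) 3) ⊎
                (HasDiam (removeEdge (F i) a b) 3 × HasDiam (removeEdge (F j) a b) 2))))
lemma11 = 24 , 24 , λ n 24≤n →
  let room = quarter-room n 24≤n
      open Construction {n} {n / 4} room
      open Layout {n} {n / 4} room using (xv; yv)
  in 2 ^ (n / 4 * (n / 4)) ,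
     ^-monoʳ-≤ 2 (square/25≤quarter² n (≤-trans (12≤24) 24≤n)) ,
     (λ i → G (bitPattern i)) ,
     (λ i → G-simple (bitPattern i)) ,
     (λ i a b → removeEdge-diam-2-or-3 (bitPattern i) a b) ,
     λ i j i≢j → let (p , q , differ) = bitPattern-≢ i≢j
                 in xv p , yv q , bit-separates room (bitPattern i) (bitPattern j) p q differ
  where
    12≤24 : 12 ≤ 24
    12≤24 = m≤m+n 12 12
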